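{- Let $V$ be a finite set and $U_1,\dots,U_k$ a partition of $V$. Let $\mathcal{U} = \{ \bigcup_{i \in I} U_i : I \subseteq \{1,\dots,k\}\}$ and define $f \colon 2^V \to \mathbb{R}$ by $f(X) = \min_{W \in \mathcal{U}} |X \vartriangle W|$. Then $f$ is submodular.
   Context: $X \vartriangle W$ is the symmetric difference. $f$ is submodular if $f(X)+f(Y) \ge f(X \cup Y) + f(X \cap Y)$ for all $X,Y \subseteq V$. -}

module Defs where

open import Data.Nat using (ℕ; zero; suc; _⊓_; _+_; _≤_)
open import Data.Fin using (Fin)
open import Data.Fin.Subset using (Subset; inside; outside; _∪_; _∩_; _─_; ∣_∣)
open import Data.Vec using ([]; _∷_; lookup; tabulate)
open import Data.Product using (∃)
open import Relation.Binary.PropositionalEquality using (_≡_)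

_△_ : ∀ {n} → Subset n → Subset n → Subset n
X △ W = (X ─ W) ∪ (W ─ X)

-- A partition U₁,…,U_k of V = Fin n is given by the block-assignment map
-- p : Fin n → Fin k (U_i = p⁻¹(i)); blocks of a partition are nonempty,
-- i.e. p is surjective.
IsPartition : ∀ {n k} → (Fin n → Fin k) → Set
IsPartition {n} {k} p = ∀ (i : Fin k) → ∃ λ (v : Fin n) → p v ≡ i

blockUnion : ∀ {n k} → (Fin n → Fin k) → Subset k → Subset n
blockUnion p I = tabulate (λ v → lookup I (p v))

minSubsets : ∀ {k} → (Subset k → ℕ) → ℕ
minSubsets {zero}  g = g []
minSubsets {suc k} g = minSubsets (λ I → g (outside ∷ I)) ⊓ minSubsets (λ I → g (inside ∷ I))

distToUnions : ∀ {n k} → (Fin n → Fin k) → Subset n → ℕ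
distToUnions p X = minSubsets (λ I → ∣ X △ blockUnion p I ∣)

Submodular : ∀ {n} → (Subset n → ℕ) → Set
Submodular {n} f = ∀ (X Y : Subset n) → f (X ∪ Y) + f (X ∩ Y) ≤ f X + f Y

module Submission where

-- For a map p : Fin n → Fin k the block unions W = blockUnion p I form a
-- family of subsets of Fin n closed under ∪ and ∩, because I ↦ blockUnion p I
-- commutes with pointwise Boolean operations.  The proof shows that for ANY
-- such lattice homomorphism u : Subset k → Subset n the function
-- f(X) = min_I |X △ u I| is submodular:
--   * Hamming distance is "lattice-submodular":
--       |(X∪Y) △ (A∪B)| + |(X∩Y) △ (A∩B)| ≤ |X △ A| + |Y △ B|,
--     proved coordinatewise (a 16-case Boolean check) and summed by induction;
--   * choosing minimisers I, J for X, Y, the candidates I ∪ J and I ∩ J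
--     bound f(X∪Y) + f(X∩Y) by |X △ u I| + |Y △ u J| = f X + f Y.

open import Defs
open import Data.Nat using (ℕ; zero; suc; _+_; _≤_; _⊓_; _≤?_; z≤n)
open import Data.Nat.Properties
  using (≤-refl; ≤-trans; +-mono-≤; m⊓n≤m; m⊓n≤n; ⊓-sel; +-commutativeSemigroup; module ≤-Reasoning)
open import Algebra.Properties.CommutativeSemigroup +-commutativeSemigroup using (interchange)
open import Data.Fin using (Fin)
import Data.Fin as Fin
open import Data.Fin.Subset using (Subset; inside; outside; _∪_; _∩_; ∣_∣)
open import Data.Bool using (Bool; true; false; _∨_; _∧_)
open import Data.Vec using ([]; _∷_; zipWith)
open import Data.Vec.Properties using (lookup-zipWith)
open import Data.Product using (∃; _,_)
open import Data.Sum using (inj₁; inj₂)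
open import Relation.Binary.PropositionalEquality using (_≡_; refl; sym; trans; cong₂)
open import Relation.Nullary.Decidable using (True; toWitness)

mismatch : Bool → Bool → ℕ
mismatch true  true  = 0
mismatch true  false = 1
mismatch false true  = 1
mismatch false false = 0

∣△∣-∷ : ∀ {n} x a (X A : Subset n) →
  ∣ (x ∷ X) △ (a ∷ A) ∣ ≡ mismatch x a + ∣ X △ A ∣
∣△∣-∷ true  true  X A = refl
∣△∣-∷ true  false X A = refl
∣△∣-∷ false true  X A = refl
∣△∣-∷ false false X A = refl

byComputation : ∀ {m n} {m≤n : True (m ≤? n)} → m ≤ n
byComputation {m≤n = m≤n} = toWitness m≤n

mismatch-lattice : ∀ x y a b →
  mismatch (x ∨ y) (a ∨ b) + mismatch (x ∧ y) (a ∧ b) ≤ mismatch x a + mismatch y b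
mismatch-lattice true  true  true  true  = byComputation
mismatch-lattice true  true  true  false = byComputation
mismatch-lattice true  true  false true  = byComputation
mismatch-lattice true  true  false false = byComputation
mismatch-lattice true  false true  true  = byComputation
mismatch-lattice true  false true  false = byComputation
mismatch-lattice true  false false true  = byComputation
mismatch-lattice true  false false false = byComputation
mismatch-lattice false true  true  true  = byComputation
mismatch-lattice false true  true  false = byComputation
mismatch-lattice false true  false true  = byComputation
mismatch-lattice false true  false false = byComputation
mismatch-lattice false false true  true  = byComputation
mismatch-lattice false false true  false = byComputation
mismatch-lattice false false false true  = byComputation
mismatch-lattice false false false false = byComputation

△-lattice : ∀ {n} (X Y A B : Subset n) →
  ∣ (X ∪ Y) △ (A ∪ B) ∣ + ∣ (X ∩ Y) △ (A ∩ B) ∣ ≤ ∣ X △ A ∣ + ∣ Y △ B ∣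
△-lattice [] [] [] [] = z≤n
△-lattice (x ∷ X) (y ∷ Y) (a ∷ A) (b ∷ B) = begin
  ∣ ((x ∨ y) ∷ X ∪ Y) △ ((a ∨ b) ∷ A ∪ B) ∣ + ∣ (x ∧ y ∷ X ∩ Y) △ (a ∧ b ∷ A ∩ B) ∣
    ≡⟨ cong₂ _+_ (∣△∣-∷ (x ∨ y) (a ∨ b) (X ∪ Y) (A ∪ B)) (∣△∣-∷ (x ∧ y) (a ∧ b) (X ∩ Y) (A ∩ B)) ⟩
  (mismatch (x ∨ y) (a ∨ b) + ∣ (X ∪ Y) △ (A ∪ B) ∣) + (mismatch (x ∧ y) (a ∧ b) + ∣ (X ∩ Y) △ (A ∩ B) ∣)
    ≡⟨ interchange (mismatch (x ∨ y) (a ∨ b)) _ _ _ ⟩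
  (mismatch (x ∨ y) (a ∨ b) + mismatch (x ∧ y) (a ∧ b)) + (∣ (X ∪ Y) △ (A ∪ B) ∣ + ∣ (X ∩ Y) △ (A ∩ B) ∣)
    ≤⟨ +-mono-≤ (mismatch-lattice x y a b) (△-lattice X Y A B) ⟩
  (mismatch x a + mismatch y b) + (∣ X △ A ∣ + ∣ Y △ B ∣)
    ≡⟨ interchange (mismatch x a) _ _ _ ⟩
  (mismatch x a + ∣ X △ A ∣) + (mismatch y b + ∣ Y △ B ∣)
    ≡⟨ sym (cong₂ _+_ (∣△∣-∷ x a X A) (∣△∣-∷ y b Y B)) ⟩
  ∣ (x ∷ X) △ (a ∷ A) ∣ + ∣ (y ∷ Y) △ (b ∷ B) ∣ ∎
  where open ≤-Reasoning

blockUnion-zipWith : ∀ {n k} (f : Bool → Bool → Bool) (p : Fin n → Fin k) (I J : Subset k) →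
  blockUnion p (zipWith f I J) ≡ zipWith f (blockUnion p I) (blockUnion p J)
blockUnion-zipWith {zero}  f p I J = refl
blockUnion-zipWith {suc n} f p I J =
  cong₂ _∷_ (lookup-zipWith f (p Fin.zero) I J) (blockUnion-zipWith f (λ v → p (Fin.suc v)) I J)

minSubsets-≤ : ∀ {k} (g : Subset k → ℕ) (I : Subset k) → minSubsets g ≤ g I
minSubsets-≤ {zero}  g []          = ≤-refl
minSubsets-≤ {suc k} g (false ∷ I) = ≤-trans (m⊓n≤m _ _) (minSubsets-≤ (λ J → g (outside ∷ J)) I)
minSubsets-≤ {suc k} g (true ∷ I)  = ≤-trans (m⊓n≤n _ _) (minSubsets-≤ (λ J → g (inside ∷ J)) I)

minSubsets-attained : ∀ {k} (g : Subset k → ℕ) → ∃ λ I → minSubsets g ≡ g I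
minSubsets-attained {zero}  g = [] , refl
minSubsets-attained {suc k} g
  with ⊓-sel (minSubsets (λ J → g (outside ∷ J))) (minSubsets (λ J → g (inside ∷ J)))
... | inj₁ min≡out with minSubsets-attained (λ J → g (outside ∷ J))
...   | I , out≡g = (outside ∷ I) , trans min≡out out≡g
minSubsets-attained {suc k} g | inj₂ min≡in with minSubsets-attained (λ J → g (inside ∷ J))
...   | I , in≡g = (inside ∷ I) , trans min≡in in≡g

distance-submodular : ∀ {n k} (u : Subset k → Subset n) →
  (∀ I J → u (I ∪ J) ≡ u I ∪ u J) → (∀ I J → u (I ∩ J) ≡ u I ∩ u J) →
  Submodular (λ X → minSubsets (λ I → ∣ X △ u I ∣))
distance-submodular u u-∪ u-∩ X Y
  with minSubsets-attained (λ I → ∣ X △ u I ∣) | minSubsets-attained (λ I → ∣ Y △ u I ∣)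
... | I , fX≡ | J , fY≡ = begin
  dist (X ∪ Y) + dist (X ∩ Y)
    ≤⟨ +-mono-≤ (minSubsets-≤ _ (I ∪ J)) (minSubsets-≤ _ (I ∩ J)) ⟩
  ∣ (X ∪ Y) △ u (I ∪ J) ∣ + ∣ (X ∩ Y) △ u (I ∩ J) ∣
    ≡⟨ cong₂ (λ W W′ → ∣ (X ∪ Y) △ W ∣ + ∣ (X ∩ Y) △ W′ ∣) (u-∪ I J) (u-∩ I J) ⟩
  ∣ (X ∪ Y) △ (u I ∪ u J) ∣ + ∣ (X ∩ Y) △ (u I ∩ u J) ∣
    ≤⟨ △-lattice X Y (u I) (u J) ⟩
  ∣ X △ u I ∣ + ∣ Y △ u J ∣
    ≡⟨ sym (cong₂ _+_ fX≡ fY≡) ⟩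
  dist X + dist Y ∎
  where
  open ≤-Reasoning
  dist : Subset _ → ℕ
  dist Z = minSubsets (λ I → ∣ Z △ u I ∣)

proposition3p11 : (n k : ℕ) (p : Fin n → Fin k) → IsPartition p →
    Submodular (distToUnions p)
proposition3p11 n k p _ =
  distance-submodular (blockUnion p) (blockUnion-zipWith _∨_ p) (blockUnion-zipWith _∧_ p)
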